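{- Let $P\in\mathcal P(w_0^{(n+1)})$. Then $P$ contains a unique chain $\mathsf D(P)=\{d_1<_P d_2<_P\cdots<_P d_n\}$ with $f_P(d_i)=n+1-i$ for all $1\le i\le n$, and a unique chain $\mathsf A(P)=\{a_1<_P a_2<_P\cdots<_P a_n\}$ with $f_P(a_i)=i$ for all $1\le i\le n$. Moreover $|\mathsf D(P)\cap\mathsf A(P)|=1$.
   Context: $\mathfrak S_{n+1}$ is the symmetric group with simple transpositions $s_i=(i,i+1)$; $\mathscr R(w)$ is the set of reduced words of $w$; $w_0^{(n+1)}$ is the longest element. A word poset is a finite poset $P$ with a function $f_P:P\to\mathbb{Z}_{>0}$; $P\sim Q$ if there is a poset isomorphism $\phi$ with $f_Q\circ\phi=f_P$. For $\mathbf i=(i_1,\dots,i_\ell)\in\mathscr R(w)$, $P_{\mathbf i}$ is the poset on $[\ell]$ which is the reflexive transitive closure of the relations $j<k$ for $j<k$ with $|i_j-i_k|=1$, with $f_{P_{\mathbf i}}(j)=i_j$. $\mathcal P(w)$ is the set of word posets isomorphic to some $P_{\mathbf i}$, $\mathbf i\in\mathscr R(w)$. -}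

module Defs where

open import Level using (0ℓ)
open import Data.Nat using (ℕ; zero; suc; _∸_; _≤_; _<_; _≟_)
open import Data.Fin using (Fin; toℕ) renaming (_<_ to _<ᶠ_)
open import Data.List using (List; []; _∷_; length; lookup)
open import Data.List.Relation.Unary.All using (All)
open import Data.Product using (Σ; _×_; _,_)
open import Data.Sum using (_⊎_)
open import Relation.Binary.PropositionalEquality using (_≡_; _≢_)
open import Relation.Binary.Structures using (IsPartialOrder)
open import Relation.Binary.Construct.Closure.ReflexiveTransitive using (Star)
open import Relation.Nullary using (yes; no)
open import Function.Bundles using (_↔_; _⇔_; Inverse)

-- Symmetric group S_{n+1}: permutations of {1,…,n+1} are represented as
-- functions ℕ → ℕ, compared only on the points 1,…,n+1.

s : ℕ → ℕ → ℕ
s i x with x ≟ i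
... | yes _ = suc i
... | no _ with x ≟ suc i
...   | yes _ = i
...   | no _ = x

prod : List ℕ → ℕ → ℕ
prod [] x = x
prod (i ∷ is) x = s i (prod is x)

w₀ : ℕ → ℕ → ℕ
w₀ n x = suc (suc n) ∸ x

Letters : ℕ → List ℕ → Set
Letters n word = All (λ i → 1 ≤ i × i ≤ n) word

Expresses : ℕ → (ℕ → ℕ) → List ℕ → Set
Expresses n w word =
  Letters n word × (∀ x → 1 ≤ x → x ≤ suc n → prod word x ≡ w x)

Reduced : ℕ → (ℕ → ℕ) → List ℕ → Set
Reduced n w word =
  Expresses n w word × (∀ word′ → Expresses n w word′ → length word ≤ length word′)

record WordPoset : Set₁ where
  field
    size   : ℕ
    _≤P_   : Fin size → Fin size → Set
    isPO   : IsPartialOrder _≡_ _≤P_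
    label  : Fin size → ℕ
    label-pos : ∀ x → 0 < label x

open WordPoset public

Gen : (word : List ℕ) → Fin (length word) → Fin (length word) → Set
Gen word j k =
  j <ᶠ k × (lookup word j ≡ suc (lookup word k) ⊎ suc (lookup word j) ≡ lookup word k)

-- order of P_𝐢 : reflexive transitive closure of Gen; f_{P_𝐢}(j) = i_j
Pw : (word : List ℕ) → Fin (length word) → Fin (length word) → Set
Pw word = Star (Gen word)

IsoToPword : WordPoset → List ℕ → Set
IsoToPword P word =
  Σ (Fin (size P) ↔ Fin (length word)) λ φ →
    (∀ x y → (_≤P_ P x y) ⇔ Pw word (Inverse.to φ x) (Inverse.to φ y)) ×
    (∀ x → lookup word (Inverse.to φ x) ≡ label P x)

InClass : ℕ → (ℕ → ℕ) → WordPoset → Set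
InClass n w P = Σ (List ℕ) λ word → Reduced n w word × IsoToPword P word

StrictP : (P : WordPoset) → Fin (size P) → Fin (size P) → Set
StrictP P x y = _≤P_ P x y × x ≢ y

-- d₁ <_P ⋯ <_P d_n with f_P(d_i) = n+1-i   (index i is 0-based here)
IsDChain : (P : WordPoset) (n : ℕ) → (Fin n → Fin (size P)) → Set
IsDChain P n d =
  (∀ i j → i <ᶠ j → StrictP P (d i) (d j)) × (∀ i → label P (d i) ≡ n ∸ toℕ i)

-- a₁ <_P ⋯ <_P a_n with f_P(a_i) = i   (index i is 0-based here)
IsAChain : (P : WordPoset) (n : ℕ) → (Fin n → Fin (size P)) → Set
IsAChain P n a =
  (∀ i j → i <ᶠ j → StrictP P (a i) (a j)) × (∀ i → label P (a i) ≡ suc (toℕ i))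

{-# OPTIONS --safe #-}
module Submission where

-- Let 𝐢 be a reduced word of w₀ and σₜ = s_{i_{t+1}} ⋯ s_{i_ℓ} its suffix products, so that
-- σ₀ = w₀ and σ_ℓ = id. Since w₀ has as many inversions as 𝐢 has letters, every letter of 𝐢
-- creates an inversion; hence the point 1 is only ever moved down, one step at a time from
-- n + 1 to 1, and the point n + 1 only up. The letters moving 1 carry the labels n, …, 1 in this
-- order, consecutive ones are covering relations of P_𝐢, and every chain with these labels is
-- forced onto them: that is D(P). The letters moving n + 1 give A(P) in the same way. The two
-- wires swap exactly once, at the single letter lying on both chains.

open import Defs
open import Data.Nat
open import Data.Nat.Properties
open import Algebra.Properties.CommutativeSemigroup +-commutativeSemigroup using (interchange)
open import Data.Empty using (⊥-elim)
open import Data.Sum using (_⊎_; inj₁; inj₂)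
open import Data.Product using (Σ; _×_; _,_; proj₁; proj₂)
open import Data.List using (List; []; _∷_; _++_; [_]; length; drop; lookup)
open import Data.List.Properties using (length-++; drop-all)
open import Data.List.Relation.Unary.All as All using ([]; _∷_)
open import Data.List.Relation.Unary.All.Properties using (++⁺; drop⁺)
open import Data.Fin using (Fin; toℕ; fromℕ<; fromℕ)
  renaming (zero to fzero; suc to fsuc; _<_ to _<ᶠ_)
open import Data.Fin.Properties using (toℕ<n; toℕ-fromℕ<; toℕ-fromℕ; ≤fromℕ)
  renaming (<-cmp to <ᶠ-cmp; _≟_ to _≟ᶠ_; ≤∧≢⇒< to ≤∧≢⇒<ᶠ)
open import Function using (_∘_; id)
open import Function.Bundles using (Inverse; Equivalence)
open import Relation.Binary.Core using (Rel)
open import Relation.Binary.Definitions using (Reflexive; tri<; tri≈; tri>)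
open import Relation.Binary.PropositionalEquality
  using (_≡_; _≢_; refl; sym; trans; cong; cong₂; subst; subst₂; module ≡-Reasoning)
open import Relation.Binary.Construct.Closure.ReflexiveTransitive using (Star; ε; _◅_; fold)
open import Relation.Nullary using (Dec; yes; no; ¬_; contradiction)
open import Relation.Unary using (Pred)

sᵢi≡1+i : ∀ i → s i i ≡ suc i
sᵢi≡1+i i with i ≟ i
... | yes _ = refl
... | no i≢i = contradiction refl i≢i

sᵢ[1+i]≡i : ∀ i → s i (suc i) ≡ i
sᵢ[1+i]≡i i with suc i ≟ i
... | yes 1+i≡i = contradiction 1+i≡i 1+n≢n
... | no _ with suc i ≟ suc i
...   | yes _ = refl
...   | no 1+i≢1+i = contradiction refl 1+i≢1+i

sᵢx≡x : ∀ {i x} → x ≢ i → x ≢ suc i → s i x ≡ x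
sᵢx≡x {i} {x} x≢i x≢1+i with x ≟ i
... | yes x≡i = contradiction x≡i x≢i
... | no _ with x ≟ suc i
...   | yes x≡1+i = contradiction x≡1+i x≢1+i
...   | no _ = refl

data SView (i x y : ℕ) : Set where
  at-i      : x ≡ i → y ≡ suc i → SView i x y
  at-1+i    : x ≡ suc i → y ≡ i → SView i x y
  elsewhere : x ≢ i → x ≢ suc i → y ≡ x → SView i x y

sview : ∀ i x → SView i x (s i x)
sview i x = cases (x ≟ i) (x ≟ suc i)
  where
  cases : Dec (x ≡ i) → Dec (x ≡ suc i) → SView i x (s i x)
  cases (yes x≡i) _ = at-i x≡i (trans (cong (s i) x≡i) (sᵢi≡1+i i))
  cases (no _) (yes x≡1+i) = at-1+i x≡1+i (trans (cong (s i) x≡1+i) (sᵢ[1+i]≡i i))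
  cases (no x≢i) (no x≢1+i) = elsewhere x≢i x≢1+i (sᵢx≡x x≢i x≢1+i)

s-involutive : ∀ i x → s i (s i x) ≡ x
s-involutive i x with sview i x
... | at-i refl eq = trans (cong (s i) eq) (sᵢ[1+i]≡i i)
... | at-1+i refl eq = trans (cong (s i) eq) (sᵢi≡1+i i)
... | elsewhere _ _ eq = trans (cong (s i) eq) eq

s-injective : ∀ i {x y} → s i x ≡ s i y → x ≡ y
s-injective i {x} {y} eq =
  trans (sym (s-involutive i x)) (trans (cong (s i) eq) (s-involutive i y))

s-<-cases : ∀ i a b → s i b < s i a → b < a ⊎ (a ≡ i × b ≡ suc i)
s-<-cases i a b lt with sview i a | sview i b
... | at-i refl _ | at-1+i refl _ = inj₂ (refl , refl)
... | at-i _ ea | at-i _ eb = contradiction (trans eb (sym ea)) (<⇒≢ lt)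
... | at-1+i _ ea | at-1+i _ eb = contradiction (trans eb (sym ea)) (<⇒≢ lt)
... | at-1+i _ ea | at-i _ eb = contradiction (subst₂ _<_ eb ea lt) (<-asym (n<1+n i))
... | at-i refl ea | elsewhere b≢i _ eb = inj₁ (≤∧≢⇒< (s≤s⁻¹ (subst₂ _<_ eb ea lt)) b≢i)
... | at-1+i refl ea | elsewhere _ _ eb = inj₁ (m<n⇒m<1+n (subst₂ _<_ eb ea lt))
... | elsewhere _ _ ea | at-i refl eb = inj₁ (<-trans (n<1+n i) (subst₂ _<_ eb ea lt))
... | elsewhere _ a≢1+i ea | at-1+i refl eb =
  inj₁ (≤∧≢⇒< (subst₂ _<_ eb ea lt) (a≢1+i ∘ sym))
... | elsewhere _ _ ea | elsewhere _ _ eb = inj₁ (subst₂ _<_ eb ea lt)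

prod-++ : ∀ u v x → prod (u ++ v) x ≡ prod u (prod v x)
prod-++ [] v x = refl
prod-++ (i ∷ u) v x = cong (s i) (prod-++ u v x)

prod-injective : ∀ v {x y} → prod v x ≡ prod v y → x ≡ y
prod-injective [] eq = eq
prod-injective (i ∷ v) eq = prod-injective v (s-injective i eq)

prod-fixes-above : ∀ {n} v {x} → Letters n v → suc n < x → prod v x ≡ x
prod-fixes-above [] _ _ = refl
prod-fixes-above (i ∷ v) {x} ((_ , i≤n) ∷ letters) n<x =
  trans (cong (s i) (prod-fixes-above v letters n<x))
        (sᵢx≡x (λ { refl → <⇒≱ n<x (m≤n⇒m≤1+n i≤n) }) (λ { refl → <⇒≱ n<x (s≤s i≤n) }))

InRange : ℕ → ℕ → Set
InRange n x = 1 ≤ x × x ≤ suc n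

s-preserves-range : ∀ {n i x} → 1 ≤ i → i ≤ n → InRange n x → InRange n (s i x)
s-preserves-range {n} {i} {x} 1≤i i≤n x∈ with sview i x
... | at-i _ eq = subst (InRange n) (sym eq) (s≤s z≤n , s≤s i≤n)
... | at-1+i _ eq = subst (InRange n) (sym eq) (1≤i , m≤n⇒m≤1+n i≤n)
... | elsewhere _ _ eq = subst (InRange n) (sym eq) x∈

prod-preserves-range : ∀ {n} v {x} → Letters n v → InRange n x → InRange n (prod v x)
prod-preserves-range [] _ x∈ = x∈
prod-preserves-range (i ∷ v) ((1≤i , i≤n) ∷ letters) x∈ =
  s-preserves-range 1≤i i≤n (prod-preserves-range v letters x∈)

-- Finite sums and inversions

sumTo : (ℕ → ℕ) → ℕ → ℕ
sumTo f zero = 0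
sumTo f (suc m) = sumTo f m + f (suc m)

sumTo-mono-≤ : ∀ {f g} m → (∀ x → 1 ≤ x → x ≤ m → f x ≤ g x) → sumTo f m ≤ sumTo g m
sumTo-mono-≤ zero _ = z≤n
sumTo-mono-≤ (suc m) f≤g =
  +-mono-≤ (sumTo-mono-≤ m (λ x 1≤x x≤m → f≤g x 1≤x (m≤n⇒m≤1+n x≤m)))
           (f≤g (suc m) (s≤s z≤n) ≤-refl)

sumTo-cong : ∀ {f g} m → (∀ x → 1 ≤ x → x ≤ m → f x ≡ g x) → sumTo f m ≡ sumTo g m
sumTo-cong zero _ = refl
sumTo-cong (suc m) f≡g =
  cong₂ _+_ (sumTo-cong m (λ x 1≤x x≤m → f≡g x 1≤x (m≤n⇒m≤1+n x≤m)))
            (f≡g (suc m) (s≤s z≤n) ≤-refl)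

sumTo-zero : ∀ {f} m → (∀ x → 1 ≤ x → x ≤ m → f x ≡ 0) → sumTo f m ≡ 0
sumTo-zero m f≡0 = trans (sumTo-cong m f≡0) (sumTo-const0 m)
  where
  sumTo-const0 : ∀ m → sumTo (λ _ → 0) m ≡ 0
  sumTo-const0 zero = refl
  sumTo-const0 (suc m) = cong (_+ 0) (sumTo-const0 m)

sumTo-const1 : ∀ m → sumTo (λ _ → 1) m ≡ m
sumTo-const1 zero = refl
sumTo-const1 (suc m) = trans (cong (_+ 1) (sumTo-const1 m)) (+-comm m 1)

sumTo-+ : ∀ f g m → sumTo (λ x → f x + g x) m ≡ sumTo f m + sumTo g m
sumTo-+ f g zero = refl
sumTo-+ f g (suc m) =
  trans (cong (_+ (f (suc m) + g (suc m))) (sumTo-+ f g m))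
        (interchange (sumTo f m) (sumTo g m) (f (suc m)) (g (suc m)))

sumTo-*ʳ : ∀ f c m → sumTo (λ x → f x * c) m ≡ sumTo f m * c
sumTo-*ʳ f c zero = refl
sumTo-*ʳ f c (suc m) =
  trans (cong (_+ f (suc m) * c) (sumTo-*ʳ f c m)) (sym (*-distribʳ-+ c (sumTo f m) (f (suc m))))

𝟙 : ∀ {a} {A : Set a} → Dec A → ℕ
𝟙 (yes _) = 1
𝟙 (no _) = 0

𝟙-yes : ∀ {a} {A : Set a} (d : Dec A) → A → 𝟙 d ≡ 1
𝟙-yes (yes _) _ = refl
𝟙-yes (no ¬p) p = contradiction p ¬p

𝟙-no : ∀ {a} {A : Set a} (d : Dec A) → ¬ A → 𝟙 d ≡ 0
𝟙-no (yes p) ¬p = contradiction p ¬p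
𝟙-no (no _) _ = refl

sumTo-𝟙≤1 : ∀ (f : ℕ → ℕ) c m → (∀ x y → f x ≡ c → f y ≡ c → x ≡ y) →
            sumTo (λ x → 𝟙 (f x ≟ c)) m ≤ 1
sumTo-𝟙≤1 f c zero _ = z≤n
sumTo-𝟙≤1 f c (suc m) unique with f (suc m) ≟ c
... | yes fm≡c = ≤-reflexive (cong (_+ 1) (sumTo-zero m earlier≡0))
  where
  earlier≡0 : ∀ x → 1 ≤ x → x ≤ m → 𝟙 (f x ≟ c) ≡ 0
  earlier≡0 x _ x≤m =
    𝟙-no (f x ≟ c) (λ fx≡c → 1+n≰n (subst (_≤ m) (unique x (suc m) fx≡c fm≡c) x≤m))
... | no _ = ≤-trans (≤-reflexive (+-identityʳ _)) (sumTo-𝟙≤1 f c m unique)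

inversions : (ℕ → ℕ) → ℕ → ℕ
inversions σ N = sumTo (λ y → sumTo (λ x → 𝟙 (σ y <? σ x)) (pred y)) N

Ascent : ℕ → (ℕ → ℕ) → ℕ → Set
Ascent N σ i = Σ ℕ λ x → Σ ℕ λ y → 1 ≤ x × x < y × y ≤ N × σ x ≡ i × σ y ≡ suc i

ascents : (ℕ → ℕ) → ℕ → ℕ → ℕ
ascents σ i N = sumTo (λ y → sumTo (λ x → 𝟙 (σ x ≟ i) * 𝟙 (σ y ≟ suc i)) (pred y)) N

𝟙-inversion-s : ∀ i a b → 𝟙 (s i b <? s i a) ≤ 𝟙 (b <? a) + 𝟙 (a ≟ i) * 𝟙 (b ≟ suc i)
𝟙-inversion-s i a b with s i b <? s i a
... | no _ = z≤n
... | yes lt with s-<-cases i a b lt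
...   | inj₁ b<a rewrite 𝟙-yes (b <? a) b<a = s≤s z≤n
...   | inj₂ (refl , refl) rewrite 𝟙-yes (i ≟ i) refl | 𝟙-yes (suc i ≟ suc i) refl = m≤n+m 1 _

inversions-s∘ : ∀ σ i N → inversions (s i ∘ σ) N ≤ inversions σ N + ascents σ i N
inversions-s∘ σ i N = ≤-trans
  (sumTo-mono-≤ N (λ y _ _ → ≤-trans
    (sumTo-mono-≤ (pred y) (λ x _ _ → 𝟙-inversion-s i (σ x) (σ y)))
    (≤-reflexive (sumTo-+ _ _ (pred y)))))
  (≤-reflexive (sumTo-+ _ _ N))

ascents≤1 : ∀ σ i N → (∀ x y → σ x ≡ σ y → x ≡ y) → ascents σ i N ≤ 1
ascents≤1 σ i N injective = ≤-trans
  (sumTo-mono-≤ N (λ y _ _ → column≤ y))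
  (sumTo-𝟙≤1 σ (suc i) N (λ x y e e′ → injective x y (trans e (sym e′))))
  where
  open ≤-Reasoning
  column≤ : ∀ y → sumTo (λ x → 𝟙 (σ x ≟ i) * 𝟙 (σ y ≟ suc i)) (pred y) ≤ 𝟙 (σ y ≟ suc i)
  column≤ y = begin
    sumTo (λ x → 𝟙 (σ x ≟ i) * 𝟙 (σ y ≟ suc i)) (pred y)
      ≡⟨ sumTo-*ʳ (λ x → 𝟙 (σ x ≟ i)) _ (pred y) ⟩
    sumTo (λ x → 𝟙 (σ x ≟ i)) (pred y) * 𝟙 (σ y ≟ suc i)
      ≤⟨ *-monoˡ-≤ _ (sumTo-𝟙≤1 σ i (pred y) (λ x z e e′ → injective x z (trans e (sym e′)))) ⟩
    1 * 𝟙 (σ y ≟ suc i)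
      ≡⟨ *-identityˡ _ ⟩
    𝟙 (σ y ≟ suc i) ∎

ascents≡0 : ∀ σ i N → ¬ Ascent N σ i → ascents σ i N ≡ 0
ascents≡0 σ i N noAscent =
  sumTo-zero N λ y _ y≤N → sumTo-zero (pred y) λ x 1≤x x<y → term x y 1≤x x<y y≤N
  where
  term : ∀ x y → 1 ≤ x → x ≤ pred y → y ≤ N → 𝟙 (σ x ≟ i) * 𝟙 (σ y ≟ suc i) ≡ 0
  term x zero 1≤x x≤0 _ = contradiction (≤-trans 1≤x x≤0) λ ()
  term x (suc y) 1≤x x≤y y<N with σ x ≟ i | σ (suc y) ≟ suc i
  ... | yes σx≡i | yes σy≡1+i = contradiction (x , suc y , 1≤x , s≤s x≤y , y<N , σx≡i , σy≡1+i) noAscent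
  ... | yes _ | no _ = refl
  ... | no _ | _ = refl

inversions-cong : ∀ {σ τ} N → (∀ x → 1 ≤ x → x ≤ N → σ x ≡ τ x) →
                  inversions σ N ≡ inversions τ N
inversions-cong N σ≡τ = sumTo-cong N λ y 1≤y y≤N → sumTo-cong (pred y) λ x 1≤x x<y →
  cong₂ (λ a b → 𝟙 (a <? b)) (σ≡τ y 1≤y y≤N)
                             (σ≡τ x 1≤x (≤-trans x<y (≤-trans pred[n]≤n y≤N)))

inversions-id : ∀ N → inversions id N ≡ 0
inversions-id N = sumTo-zero N λ y _ _ → sumTo-zero (pred y) λ x _ x<y →
  𝟙-no (y <? x) (λ y<x → <⇒≱ y<x (≤-trans x<y pred[n]≤n))

inversions-w₀ : ∀ n → inversions (w₀ n) (suc n) ≡ sumTo pred (suc n)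
inversions-w₀ n = sumTo-cong (suc n) λ y 1≤y y≤1+n →
  trans (sumTo-cong (pred y) (λ x _ x<y → 𝟙-yes (_ <? _) (w₀-reverses x y 1≤y y≤1+n x<y)))
        (sumTo-const1 (pred y))
  where
  w₀-reverses : ∀ x y → 1 ≤ y → y ≤ suc n → x ≤ pred y → w₀ n y < w₀ n x
  w₀-reverses x (suc y) _ y<1+n x≤y = ∸-monoʳ-< (s≤s x≤y) (m≤n⇒m≤1+n y<1+n)

inversions-s∘-≤suc : ∀ σ i N → (∀ x y → σ x ≡ σ y → x ≡ y) →
                     inversions (s i ∘ σ) N ≤ suc (inversions σ N)
inversions-s∘-≤suc σ i N injective = ≤-trans (inversions-s∘ σ i N)
  (≤-trans (+-monoʳ-≤ (inversions σ N) (ascents≤1 σ i N injective))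
           (≤-reflexive (+-comm (inversions σ N) 1)))

inversions-s∘-¬Ascent : ∀ σ i N → ¬ Ascent N σ i → inversions (s i ∘ σ) N ≤ inversions σ N
inversions-s∘-¬Ascent σ i N noAscent = ≤-trans (inversions-s∘ σ i N)
  (≤-reflexive (trans (cong (inversions σ N +_) (ascents≡0 σ i N noAscent)) (+-identityʳ _)))

inversions-prod≤length : ∀ N v → inversions (prod v) N ≤ length v
inversions-prod≤length N [] = ≤-reflexive (inversions-id N)
inversions-prod≤length N (i ∷ v) =
  ≤-trans (inversions-s∘-≤suc (prod v) i N (λ _ _ → prod-injective v)) (s≤s (inversions-prod≤length N v))

-- Junk value 0 past the end of the word.
letter : List ℕ → ℕ → ℕ
letter [] _ = 0
letter (i ∷ v) zero = i
letter (i ∷ v) (suc t) = letter v t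

inversions-prod<length : ∀ N v t → t < length v →
  ¬ Ascent N (prod (drop (suc t) v)) (letter v t) → inversions (prod v) N < length v
inversions-prod<length N (i ∷ v) zero _ noAscent =
  s≤s (≤-trans (inversions-s∘-¬Ascent (prod v) i N noAscent) (inversions-prod≤length N v))
inversions-prod<length N (i ∷ v) (suc t) (s≤s t<l) noAscent =
  s≤s (≤-trans (inversions-s∘-≤suc (prod v) i N (λ _ _ → prod-injective v))
               (inversions-prod<length N v t t<l noAscent))

-- A reduced word for w₀

cycleWord : ℕ → List ℕ
cycleWord zero = []
cycleWord (suc m) = cycleWord m ++ [ suc m ]

w₀Word : ℕ → List ℕ
w₀Word zero = []
w₀Word (suc n) = cycleWord (suc n) ++ w₀Word n

prod-cycleWord-suc : ∀ m x → prod (cycleWord (suc m)) x ≡ prod (cycleWord m) (s (suc m) x)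
prod-cycleWord-suc m x = prod-++ (cycleWord m) [ suc m ] x

prod-cycleWord-fixes : ∀ m x → suc m < x → prod (cycleWord m) x ≡ x
prod-cycleWord-fixes zero x _ = refl
prod-cycleWord-fixes (suc m) x 1+m<x = begin
  prod (cycleWord (suc m)) x       ≡⟨ prod-cycleWord-suc m x ⟩
  prod (cycleWord m) (s (suc m) x) ≡⟨ cong (prod (cycleWord m)) fixed ⟩
  prod (cycleWord m) x             ≡⟨ prod-cycleWord-fixes m x (<-trans (n<1+n (suc m)) 1+m<x) ⟩
  x ∎
  where
  open ≡-Reasoning
  fixed : s (suc m) x ≡ x
  fixed = sᵢx≡x (λ { refl → <-asym 1+m<x (n<1+n (suc m)) }) (λ { refl → <-irrefl refl 1+m<x })

prod-cycleWord-top : ∀ m → prod (cycleWord m) (suc m) ≡ 1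
prod-cycleWord-top zero = refl
prod-cycleWord-top (suc m) =
  trans (prod-cycleWord-suc m (suc (suc m)))
        (trans (cong (prod (cycleWord m)) (sᵢ[1+i]≡i (suc m))) (prod-cycleWord-top m))

prod-cycleWord-shifts : ∀ m x → 1 ≤ x → x ≤ m → prod (cycleWord m) x ≡ suc x
prod-cycleWord-shifts zero x 1≤x x≤0 = contradiction (≤-trans 1≤x x≤0) λ ()
prod-cycleWord-shifts (suc m) x 1≤x x≤1+m with x ≟ suc m
... | yes refl =
  trans (prod-cycleWord-suc m (suc m))
        (trans (cong (prod (cycleWord m)) (sᵢi≡1+i (suc m))) (prod-cycleWord-fixes m (suc (suc m)) ≤-refl))
... | no x≢1+m =
  trans (prod-cycleWord-suc m x)
        (trans (cong (prod (cycleWord m)) (sᵢx≡x x≢1+m (λ { refl → 1+n≰n x≤1+m })))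
               (prod-cycleWord-shifts m x 1≤x (s≤s⁻¹ (≤∧≢⇒< x≤1+m x≢1+m))))

cycleWord-letters : ∀ m n → m ≤ n → Letters n (cycleWord m)
cycleWord-letters zero n _ = []
cycleWord-letters (suc m) n 1+m≤n = ++⁺ (cycleWord-letters m n (<⇒≤ 1+m≤n)) ((s≤s z≤n , 1+m≤n) ∷ [])

w₀Word-letters : ∀ n → Letters n (w₀Word n)
w₀Word-letters zero = []
w₀Word-letters (suc n) =
  ++⁺ (cycleWord-letters (suc n) (suc n) ≤-refl)
      (All.map (λ (1≤i , i≤n) → 1≤i , m≤n⇒m≤1+n i≤n) (w₀Word-letters n))

prod-w₀Word : ∀ n x → 1 ≤ x → x ≤ suc n → prod (w₀Word n) x ≡ w₀ n x
prod-w₀Word zero .1 (s≤s z≤n) (s≤s z≤n) = refl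
prod-w₀Word (suc n) x 1≤x x≤2+n with x ≟ suc (suc n)
... | yes refl = begin
  prod (cycleWord (suc n) ++ w₀Word n) (suc (suc n))
    ≡⟨ prod-++ (cycleWord (suc n)) (w₀Word n) _ ⟩
  prod (cycleWord (suc n)) (prod (w₀Word n) (suc (suc n)))
    ≡⟨ cong (prod (cycleWord (suc n))) (prod-fixes-above (w₀Word n) (w₀Word-letters n) ≤-refl) ⟩
  prod (cycleWord (suc n)) (suc (suc n))
    ≡⟨ prod-cycleWord-top (suc n) ⟩
  1
    ≡⟨ m+n∸n≡m 1 (suc (suc n)) ⟨
  w₀ (suc n) (suc (suc n)) ∎
  where open ≡-Reasoning
... | no x≢2+n = begin
  prod (cycleWord (suc n) ++ w₀Word n) x
    ≡⟨ prod-++ (cycleWord (suc n)) (w₀Word n) x ⟩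
  prod (cycleWord (suc n)) (prod (w₀Word n) x)
    ≡⟨ cong (prod (cycleWord (suc n))) (prod-w₀Word n x 1≤x x≤1+n) ⟩
  prod (cycleWord (suc n)) (w₀ n x)
    ≡⟨ prod-cycleWord-shifts (suc n) (w₀ n x) (m<n⇒0<n∸m (s≤s x≤1+n)) (w₀-≤ x 1≤x) ⟩
  suc (w₀ n x)
    ≡⟨ +-∸-assoc 1 (m≤n⇒m≤1+n x≤1+n) ⟨
  w₀ (suc n) x ∎
  where
  open ≡-Reasoning
  x≤1+n : x ≤ suc n
  x≤1+n = s≤s⁻¹ (≤∧≢⇒< x≤2+n x≢2+n)
  w₀-≤ : ∀ x → 1 ≤ x → w₀ n x ≤ suc n
  w₀-≤ (suc x) _ = m∸n≤m (suc n) x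

length-cycleWord : ∀ m → length (cycleWord m) ≡ m
length-cycleWord zero = refl
length-cycleWord (suc m) =
  trans (length-++ (cycleWord m)) (trans (cong (_+ 1) (length-cycleWord m)) (+-comm m 1))

length-w₀Word : ∀ n → length (w₀Word n) ≡ sumTo pred (suc n)
length-w₀Word zero = refl
length-w₀Word (suc n) = trans (length-++ (cycleWord (suc n)))
  (trans (cong₂ _+_ (length-cycleWord (suc n)) (length-w₀Word n)) (+-comm (suc n) _))

reduced-w₀-ascent : ∀ {n word t} → Reduced n (w₀ n) word → t < length word →
  ¬ ¬ Ascent (suc n) (prod (drop (suc t) word)) (letter word t)
reduced-w₀-ascent {n} {word} {t} ((_ , expresses) , minimal) t<l noAscent =
  <-irrefl refl (begin-strict
  inversions (prod word) (suc n) <⟨ inversions-prod<length (suc n) word t t<l noAscent ⟩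
  length word                    ≤⟨ minimal (w₀Word n) (w₀Word-letters n , prod-w₀Word n) ⟩
  length (w₀Word n)              ≡⟨ length-w₀Word n ⟩
  sumTo pred (suc n)             ≡⟨ inversions-w₀ n ⟨
  inversions (w₀ n) (suc n)      ≡⟨ inversions-cong (suc n) expresses ⟨
  inversions (prod word) (suc n) ∎)
  where open ≤-Reasoning

decidable-ivt : ∀ {p} (P : ℕ → Set p) → (∀ t → Dec (P t)) → ∀ m → P 0 → ¬ P m →
                Σ ℕ λ t → t < m × P t × ¬ P (suc t)
decidable-ivt P P? zero P0 ¬P0 = contradiction P0 ¬P0
decidable-ivt P P? (suc m) P0 ¬P[1+m] with P? m
... | yes Pm = m , ≤-refl , Pm , ¬P[1+m]
... | no ¬Pm with decidable-ivt P P? m P0 ¬Pm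
...   | t , t<m , Pt , ¬P[1+t] = t , m<n⇒m<1+n t<m , Pt , ¬P[1+t]

drop-letter : ∀ v t → t < length v → drop t v ≡ letter v t ∷ drop (suc t) v
drop-letter (i ∷ v) zero _ = refl
drop-letter (i ∷ v) (suc t) (s≤s t<l) = drop-letter v t t<l

letter-bounds : ∀ {n} v t → Letters n v → t < length v → 1 ≤ letter v t × letter v t ≤ n
letter-bounds (i ∷ v) zero (bounds ∷ _) _ = bounds
letter-bounds (i ∷ v) (suc t) (_ ∷ letters) (s≤s t<l) = letter-bounds v t letters t<l

lookup≡letter : ∀ v (x : Fin (length v)) → lookup v x ≡ letter v (toℕ x)
lookup≡letter (i ∷ v) fzero = refl
lookup≡letter (i ∷ v) (fsuc x) = lookup≡letter v x

Adjacent : ℕ → ℕ → Set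
Adjacent a b = a ≡ suc b ⊎ suc a ≡ b

adjacent-sym : ∀ {a b} → Adjacent a b → Adjacent b a
adjacent-sym (inj₁ a≡1+b) = inj₂ (sym a≡1+b)
adjacent-sym (inj₂ 1+a≡b) = inj₁ (sym 1+a≡b)

adjacent-≤ : ∀ {a b} → Adjacent a b → a ≤ suc b
adjacent-≤ (inj₁ a≡1+b) = ≤-reflexive a≡1+b
adjacent-≤ (inj₂ refl) = m≤n⇒m≤1+n (n≤1+n _)

module _ {a r q} {A : Set a} {T : Rel A r} (Q : Pred A q) where

  Star-preserves : (∀ {x y} → T x y → Q x → Q y) → ∀ {x y} → Star T x y → Q x → Q y
  Star-preserves step = fold (λ x y → Q x → Q y) (λ t k → k ∘ step t) id

  Star-reflects : (∀ {x y} → T x y → Q y → Q x) → ∀ {x y} → Star T x y → Q y → Q x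
  Star-reflects step = fold (λ x y → Q y → Q x) (λ t k → step t ∘ k) id

-- The wires of 1 and n + 1

module Wires {n : ℕ} {word : List ℕ} (reduced : Reduced n (w₀ n) word) where

  N : ℕ
  N = suc n

  l : ℕ
  l = length word

  ℓ : ℕ → ℕ
  ℓ = letter word

  -- σ t is the product of the letters after position t, so σ 0 = w₀ and σ l = id, and passing
  -- letter t applies s (ℓ t) (σ-step); the wires follow the points 1 and N along the way.
  σ : ℕ → ℕ → ℕ
  σ t = prod (drop t word)

  wire₁ : ℕ → ℕ
  wire₁ t = σ t 1

  wireᴺ : ℕ → ℕ
  wireᴺ t = σ t N

  σ-step : ∀ {t} → t < l → ∀ z → σ (suc t) z ≡ s (ℓ t) (σ t z)
  σ-step {t} t<l z = trans (sym (s-involutive (ℓ t) (σ (suc t) z)))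
    (cong (λ v → s (ℓ t) (prod v z)) (sym (drop-letter word t t<l)))

  σ-view : ∀ {t} → t < l → ∀ z → SView (ℓ t) (σ t z) (σ (suc t) z)
  σ-view {t} t<l z = subst (SView (ℓ t) (σ t z)) (sym (σ-step t<l z)) (sview (ℓ t) (σ t z))

  σ-range : ∀ t z → InRange n z → InRange n (σ t z)
  σ-range t z = prod-preserves-range (drop t word) (drop⁺ t (proj₁ (proj₁ reduced)))

  wire₁-start : wire₁ 0 ≡ N
  wire₁-start = proj₂ (proj₁ reduced) 1 ≤-refl (s≤s z≤n)

  wireᴺ-start : wireᴺ 0 ≡ 1
  wireᴺ-start = trans (proj₂ (proj₁ reduced) N (s≤s z≤n) ≤-refl) (m+n∸n≡m 1 N)

  wire₁-end : wire₁ l ≡ 1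
  wire₁-end = cong (λ v → prod v 1) (drop-all l word ≤-refl)

  wireᴺ-end : wireᴺ l ≡ N
  wireᴺ-end = cong (λ v → prod v N) (drop-all l word ≤-refl)

  -- By reduced-w₀-ascent σ (suc t) takes the values ℓ t, ℓ t + 1 at some positions x < y, and
  -- necessarily y ≠ 1 and x ≠ N.
  wire₁-never-rises : ∀ {t} → t < l → wire₁ (suc t) ≢ suc (ℓ t)
  wire₁-never-rises {t} t<l rises = reduced-w₀-ascent reduced t<l
    λ (x , y , 1≤x , x<y , _ , _ , σy≡1+i) →
      <⇒≱ (subst (x <_) (prod-injective (drop (suc t) word) (trans σy≡1+i (sym rises))) x<y) 1≤x

  wireᴺ-never-falls : ∀ {t} → t < l → wireᴺ (suc t) ≢ ℓ t
  wireᴺ-never-falls {t} t<l falls = reduced-w₀-ascent reduced t<l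
    λ (x , y , _ , x<y , y≤N , σx≡i , _) →
      <⇒≱ (subst (_< y) (prod-injective (drop (suc t) word) (trans σx≡i (sym falls))) x<y) y≤N

  wire₁-falls : ∀ {t} → t < l → wire₁ (suc t) ≤ wire₁ t
  wire₁-falls t<l with σ-view t<l 1
  ... | at-i _ rises = contradiction rises (wire₁-never-rises t<l)
  ... | at-1+i before after = subst₂ _≤_ (sym after) (sym before) (n≤1+n _)
  ... | elsewhere _ _ stays = ≤-reflexive stays

  wire₁-antitone : ∀ {t u} → t ≤ u → u ≤ l → wire₁ u ≤ wire₁ t
  wire₁-antitone {u = zero} z≤n _ = ≤-refl
  wire₁-antitone {t} {suc u} t≤1+u 1+u≤l with m≤n⇒m<n∨m≡n t≤1+u
  ... | inj₂ refl = ≤-refl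
  ... | inj₁ t<1+u = ≤-trans (wire₁-falls 1+u≤l) (wire₁-antitone (s≤s⁻¹ t<1+u) (<⇒≤ 1+u≤l))

  wire₁-lands-below : ∀ {t} → t < l → wire₁ t ≤ suc (ℓ t) → wire₁ (suc t) ≤ ℓ t
  wire₁-lands-below t<l before≤ with σ-view t<l 1
  ... | at-i _ rises = contradiction rises (wire₁-never-rises t<l)
  ... | at-1+i _ after = ≤-reflexive after
  ... | elsewhere ≢ℓ ≢1+ℓ stays =
    ≤-trans (≤-reflexive stays) (<⇒≤ (≤∧≢⇒< (s≤s⁻¹ (≤∧≢⇒< before≤ ≢1+ℓ)) ≢ℓ))

  wire₁-came-from-above : ∀ {t} → t < l → ℓ t ≤ wire₁ (suc t) → suc (ℓ t) ≤ wire₁ t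
  wire₁-came-from-above t<l ≤after with σ-view t<l 1
  ... | at-i _ rises = contradiction rises (wire₁-never-rises t<l)
  ... | at-1+i before _ = ≤-reflexive (sym before)
  ... | elsewhere ≢ℓ _ stays = ≤∧≢⇒< (≤-trans ≤after (≤-reflexive stays)) (≢ℓ ∘ sym)

  wire₁-crossing : ∀ {t c} → t < l → suc c ≤ wire₁ t → wire₁ (suc t) ≤ c → ℓ t ≡ c × wire₁ t ≡ suc c
  wire₁-crossing t<l c<before after≤c with σ-view t<l 1
  ... | at-i _ rises = contradiction rises (wire₁-never-rises t<l)
  ... | at-1+i before after =
    let ℓ≡c = ≤-antisym (≤-trans (≤-reflexive (sym after)) after≤c)
                        (s≤s⁻¹ (≤-trans c<before (≤-reflexive before)))
    in ℓ≡c , trans before (cong suc ℓ≡c)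
  ... | elsewhere _ _ stays =
    contradiction (≤-trans c<before (≤-trans (≤-reflexive (sym stays)) after≤c)) 1+n≰n

  wireᴺ-rises : ∀ {t} → t < l → wireᴺ t ≤ wireᴺ (suc t)
  wireᴺ-rises t<l with σ-view t<l N
  ... | at-i before after = subst₂ _≤_ (sym before) (sym after) (n≤1+n _)
  ... | at-1+i _ falls = contradiction falls (wireᴺ-never-falls t<l)
  ... | elsewhere _ _ stays = ≤-reflexive (sym stays)

  wireᴺ-monotone : ∀ {t u} → t ≤ u → u ≤ l → wireᴺ t ≤ wireᴺ u
  wireᴺ-monotone {u = zero} z≤n _ = ≤-refl
  wireᴺ-monotone {t} {suc u} t≤1+u 1+u≤l with m≤n⇒m<n∨m≡n t≤1+u
  ... | inj₂ refl = ≤-refl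
  ... | inj₁ t<1+u = ≤-trans (wireᴺ-monotone (s≤s⁻¹ t<1+u) (<⇒≤ 1+u≤l)) (wireᴺ-rises 1+u≤l)

  wireᴺ-lands-above : ∀ {t} → t < l → ℓ t ≤ wireᴺ t → suc (ℓ t) ≤ wireᴺ (suc t)
  wireᴺ-lands-above t<l ≤before with σ-view t<l N
  ... | at-i _ after = ≤-reflexive (sym after)
  ... | at-1+i _ falls = contradiction falls (wireᴺ-never-falls t<l)
  ... | elsewhere ≢ℓ _ stays = ≤-trans (≤∧≢⇒< ≤before (≢ℓ ∘ sym)) (≤-reflexive (sym stays))

  wireᴺ-came-from-below : ∀ {t} → t < l → wireᴺ (suc t) ≤ suc (ℓ t) → wireᴺ t ≤ ℓ t
  wireᴺ-came-from-below t<l after≤ with σ-view t<l N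
  ... | at-i before _ = ≤-reflexive before
  ... | at-1+i _ falls = contradiction falls (wireᴺ-never-falls t<l)
  ... | elsewhere _ ≢1+ℓ stays = s≤s⁻¹ (≤∧≢⇒< (≤-trans (≤-reflexive (sym stays)) after≤) ≢1+ℓ)

  wireᴺ-crossing : ∀ {t c} → t < l → wireᴺ t ≤ c → suc c ≤ wireᴺ (suc t) → ℓ t ≡ c × wireᴺ t ≡ c
  wireᴺ-crossing t<l before≤c c<after with σ-view t<l N
  ... | at-i before after =
    let ℓ≡c = ≤-antisym (≤-trans (≤-reflexive (sym before)) before≤c)
                        (s≤s⁻¹ (≤-trans c<after (≤-reflexive after)))
    in ℓ≡c , trans before ℓ≡c
  ... | at-1+i _ falls = contradiction falls (wireᴺ-never-falls t<l)
  ... | elsewhere _ _ stays =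
    contradiction (≤-trans c<after (≤-trans (≤-reflexive stays) before≤c)) 1+n≰n

  -- Letter t moves wire 1 down, resp. wire N up; these letters make up D(P_𝐢), resp. A(P_𝐢).
  InD : ℕ → Set
  InD t = wire₁ t ≡ suc (ℓ t)

  InA : ℕ → Set
  InA t = wireᴺ t ≡ ℓ t

  wire₁-after-InD : ∀ {t u} → t < u → u ≤ l → InD t → wire₁ u ≤ ℓ t
  wire₁-after-InD t<u u≤l inD =
    ≤-trans (wire₁-antitone t<u u≤l) (wire₁-lands-below (<-≤-trans t<u u≤l) (≤-reflexive inD))

  wireᴺ-after-InA : ∀ {t u} → t < u → u ≤ l → InA t → suc (ℓ t) ≤ wireᴺ u
  wireᴺ-after-InA t<u u≤l inA =
    ≤-trans (wireᴺ-lands-above (<-≤-trans t<u u≤l) (≤-reflexive (sym inA))) (wireᴺ-monotone t<u u≤l)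

  InD-labels-decrease : ∀ {t u} → t < u → u < l → InD t → InD u → ℓ u < ℓ t
  InD-labels-decrease t<u u<l inD inD′ =
    ≤-trans (≤-reflexive (sym inD′)) (wire₁-after-InD t<u (<⇒≤ u<l) inD)

  InA-labels-increase : ∀ {t u} → t < u → u < l → InA t → InA u → ℓ t < ℓ u
  InA-labels-increase t<u u<l inA inA′ =
    ≤-trans (wireᴺ-after-InA t<u (<⇒≤ u<l) inA) (≤-reflexive inA′)

  wire₁≤1+ℓ-forward : ∀ {t u} → t < u → u < l → Adjacent (ℓ t) (ℓ u) →
                      wire₁ t ≤ suc (ℓ t) → wire₁ u ≤ suc (ℓ u)
  wire₁≤1+ℓ-forward t<u u<l adj below = ≤-trans (wire₁-antitone t<u (<⇒≤ u<l))
    (≤-trans (wire₁-lands-below (<-trans t<u u<l) below) (adjacent-≤ adj))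

  1+ℓ≤wire₁-backward : ∀ {t u} → t < u → u < l → Adjacent (ℓ t) (ℓ u) →
                       suc (ℓ u) ≤ wire₁ u → suc (ℓ t) ≤ wire₁ t
  1+ℓ≤wire₁-backward t<u u<l adj above = wire₁-came-from-above (<-trans t<u u<l)
    (≤-trans (adjacent-≤ adj) (≤-trans above (wire₁-antitone t<u (<⇒≤ u<l))))

  ℓ≤wireᴺ-forward : ∀ {t u} → t < u → u < l → Adjacent (ℓ t) (ℓ u) →
                    ℓ t ≤ wireᴺ t → ℓ u ≤ wireᴺ u
  ℓ≤wireᴺ-forward t<u u<l adj above = ≤-trans (adjacent-≤ (adjacent-sym adj))
    (≤-trans (wireᴺ-lands-above (<-trans t<u u<l) above) (wireᴺ-monotone t<u (<⇒≤ u<l)))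

  wireᴺ≤ℓ-backward : ∀ {t u} → t < u → u < l → Adjacent (ℓ t) (ℓ u) →
                     wireᴺ u ≤ ℓ u → wireᴺ t ≤ ℓ t
  wireᴺ≤ℓ-backward t<u u<l adj below = wireᴺ-came-from-below (<-trans t<u u<l)
    (≤-trans (wireᴺ-monotone t<u (<⇒≤ u<l)) (≤-trans below (adjacent-≤ (adjacent-sym adj))))

  Pos : Set
  Pos = Fin l

  ℓᶠ : Pos → ℕ
  ℓᶠ x = ℓ (toℕ x)

  ℓᶠ-bounds : ∀ x → 1 ≤ ℓᶠ x × ℓᶠ x ≤ n
  ℓᶠ-bounds x = letter-bounds word (toℕ x) (proj₁ (proj₁ reduced)) (toℕ<n x)

  Gen⇒adjacent : ∀ {x y : Pos} → Gen word x y → toℕ x < toℕ y × Adjacent (ℓᶠ x) (ℓᶠ y)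
  Gen⇒adjacent {x} {y} (x<y , adj) rewrite lookup≡letter word x | lookup≡letter word y = x<y , adj

  adjacent⇒Gen : ∀ {x y : Pos} → toℕ x < toℕ y → Adjacent (ℓᶠ x) (ℓᶠ y) → Gen word x y
  adjacent⇒Gen {x} {y} x<y adj rewrite lookup≡letter word x | lookup≡letter word y = x<y , adj

  at-pos : ∀ {p} (Q : ℕ → Set p) {t} → t < l → Q t → Σ Pos (Q ∘ toℕ)
  at-pos Q t<l q = fromℕ< t<l , subst Q (sym (toℕ-fromℕ< t<l)) q

  -- Only the statements of these witnesses matter; opacity keeps the type checker from unfolding
  -- them when checking the chains built from them.
  opaque
    InD-exists : ∀ {c} → 1 ≤ c → c ≤ n → Σ Pos λ x → ℓᶠ x ≡ c × InD (toℕ x)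
    InD-exists {c} 1≤c c≤n
      with decidable-ivt (λ t → suc c ≤ wire₁ t) (λ t → suc c ≤? wire₁ t) l
             (≤-trans (s≤s c≤n) (≤-reflexive (sym wire₁-start)))
             (λ c<end → 1+n≰n (≤-trans (s≤s 1≤c) (≤-trans c<end (≤-reflexive wire₁-end))))
    ... | t , t<l , c<before , c≮after with wire₁-crossing t<l c<before (s≤s⁻¹ (≰⇒> c≮after))
    ...   | ℓ≡c , before≡ =
      at-pos (λ t → ℓ t ≡ c × InD t) t<l (ℓ≡c , trans before≡ (cong suc (sym ℓ≡c)))

    InA-exists : ∀ {c} → 1 ≤ c → c ≤ n → Σ Pos λ x → ℓᶠ x ≡ c × InA (toℕ x)
    InA-exists {c} 1≤c c≤n
      with decidable-ivt (λ t → wireᴺ t ≤ c) (λ t → wireᴺ t ≤? c) l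
             (≤-trans (≤-reflexive wireᴺ-start) 1≤c)
             (λ end≤c → 1+n≰n (≤-trans (≤-reflexive (sym wireᴺ-end)) (≤-trans end≤c c≤n)))
    ... | t , t<l , before≤c , after≰c with wireᴺ-crossing t<l before≤c (≰⇒> after≰c)
    ...   | ℓ≡c , before≡ = at-pos (λ t → ℓ t ≡ c × InA t) t<l (ℓ≡c , trans before≡ (sym ℓ≡c))

    -- Wire 1 starts above wire N and ends below it, and a transposition can only swap two points
    -- sitting at ℓ t + 1 and ℓ t.
    InD∧InA-exists : 1 ≤ n → Σ Pos λ x → InD (toℕ x) × InA (toℕ x)
    InD∧InA-exists 1≤n
      with decidable-ivt (λ t → wireᴺ t < wire₁ t) (λ t → wireᴺ t <? wire₁ t) l
             (subst₂ _<_ (sym wireᴺ-start) (sym wire₁-start) (s≤s 1≤n))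
             (λ N<1 → <⇒≱ (subst₂ _<_ wireᴺ-end wire₁-end N<1) (s≤s z≤n))
    ... | t , t<l , below , ¬below
      with s-<-cases (ℓ t) (wireᴺ t) (wire₁ t) (subst₂ _<_ (σ-step t<l 1) (σ-step t<l N) swapped)
      where
      wires-differ : wire₁ (suc t) ≢ wireᴺ (suc t)
      wires-differ same =
        1+n≰n (≤-trans (s≤s 1≤n) (≤-reflexive (sym (prod-injective (drop (suc t) word) same))))
      swapped : wire₁ (suc t) < wireᴺ (suc t)
      swapped = ≤∧≢⇒< (≮⇒≥ ¬below) wires-differ
    ... | inj₁ wire₁<wireᴺ = contradiction below (<-asym wire₁<wireᴺ)
    ... | inj₂ (inA , inD) = at-pos (λ t → InD t × InA t) t<l (inD , inA)

  InD-ordered : ∀ {x y : Pos} → InD (toℕ x) → InD (toℕ y) → ℓᶠ y < ℓᶠ x → toℕ x < toℕ y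
  InD-ordered {x} {y} inD inD′ ℓy<ℓx with <ᶠ-cmp x y
  ... | tri< x<y _ _ = x<y
  ... | tri≈ _ refl _ = contradiction ℓy<ℓx (<-irrefl refl)
  ... | tri> _ _ y<x = contradiction ℓy<ℓx (<-asym (InD-labels-decrease y<x (toℕ<n x) inD′ inD))

  InA-ordered : ∀ {x y : Pos} → InA (toℕ x) → InA (toℕ y) → ℓᶠ x < ℓᶠ y → toℕ x < toℕ y
  InA-ordered {x} {y} inA inA′ ℓx<ℓy with <ᶠ-cmp x y
  ... | tri< x<y _ _ = x<y
  ... | tri≈ _ refl _ = contradiction ℓx<ℓy (<-irrefl refl)
  ... | tri> _ _ y<x = contradiction ℓx<ℓy (<-asym (InA-labels-increase y<x (toℕ<n x) inA′ inA))

  InD-injective : ∀ {x y : Pos} → InD (toℕ x) → InD (toℕ y) → ℓᶠ x ≡ ℓᶠ y → x ≡ y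
  InD-injective {x} {y} inD inD′ ℓx≡ℓy with <ᶠ-cmp x y
  ... | tri< x<y _ _ = contradiction (sym ℓx≡ℓy) (<⇒≢ (InD-labels-decrease x<y (toℕ<n y) inD inD′))
  ... | tri≈ _ x≡y _ = x≡y
  ... | tri> _ _ y<x = contradiction ℓx≡ℓy (<⇒≢ (InD-labels-decrease y<x (toℕ<n x) inD′ inD))

  InA-injective : ∀ {x y : Pos} → InA (toℕ x) → InA (toℕ y) → ℓᶠ x ≡ ℓᶠ y → x ≡ y
  InA-injective {x} {y} inA inA′ ℓx≡ℓy with <ᶠ-cmp x y
  ... | tri< x<y _ _ = contradiction ℓx≡ℓy (<⇒≢ (InA-labels-increase x<y (toℕ<n y) inA inA′))
  ... | tri≈ _ x≡y _ = x≡y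
  ... | tri> _ _ y<x = contradiction (sym ℓx≡ℓy) (<⇒≢ (InA-labels-increase y<x (toℕ<n x) inA′ inA))

  InD∧InA-unique : ∀ {x y : Pos} → InD (toℕ x) → InA (toℕ x) → InD (toℕ y) → InA (toℕ y) → x ≡ y
  InD∧InA-unique {x} {y} inD inA inD′ inA′ with <ᶠ-cmp x y
  ... | tri< x<y _ _ = ⊥-elim (<-asym (InD-labels-decrease x<y (toℕ<n y) inD inD′)
                                      (InA-labels-increase x<y (toℕ<n y) inA inA′))
  ... | tri≈ _ x≡y _ = x≡y
  ... | tri> _ _ y<x = ⊥-elim (<-asym (InD-labels-decrease y<x (toℕ<n x) inD′ inD)
                                      (InA-labels-increase y<x (toℕ<n x) inA′ inA))

  -- wire₁ ≤ ℓ + 1 is inherited upwards and wire₁ ≥ ℓ + 1 downwards along P_𝐢, and both hold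
  -- for free at the labels n and 1 respectively.
  InD-between : ∀ {y x z : Pos} → Pw word y x → Pw word x z → ℓᶠ y ≡ n → ℓᶠ z ≡ 1 → InD (toℕ x)
  InD-between {y} {x} {z} y≤x x≤z ℓy≡n ℓz≡1 =
    ≤-antisym (Star-preserves Below below-step y≤x below-y) (Star-reflects Above above-step x≤z above-z)
    where
    Below Above : Pos → Set
    Below v = wire₁ (toℕ v) ≤ suc (ℓᶠ v)
    Above v = suc (ℓᶠ v) ≤ wire₁ (toℕ v)
    below-step : ∀ {v w} → Gen word v w → Below v → Below w
    below-step {w = w} g = let v<w , adj = Gen⇒adjacent g in wire₁≤1+ℓ-forward v<w (toℕ<n w) adj
    above-step : ∀ {v w} → Gen word v w → Above w → Above v
    above-step {w = w} g = let v<w , adj = Gen⇒adjacent g in 1+ℓ≤wire₁-backward v<w (toℕ<n w) adj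
    below-y : Below y
    below-y = ≤-trans (proj₂ (σ-range (toℕ y) 1 (≤-refl , s≤s z≤n)))
                      (≤-reflexive (cong suc (sym ℓy≡n)))
    above-z : Above z
    above-z = wire₁-came-from-above (toℕ<n z)
      (≤-trans (≤-reflexive ℓz≡1) (proj₁ (σ-range (suc (toℕ z)) 1 (≤-refl , s≤s z≤n))))

  InA-between : ∀ {y x z : Pos} → Pw word y x → Pw word x z → ℓᶠ y ≡ 1 → ℓᶠ z ≡ n → InA (toℕ x)
  InA-between {y} {x} {z} y≤x x≤z ℓy≡1 ℓz≡n =
    ≤-antisym (Star-reflects Below below-step x≤z below-z) (Star-preserves Above above-step y≤x above-y)
    where
    Below Above : Pos → Set
    Below v = wireᴺ (toℕ v) ≤ ℓᶠ v
    Above v = ℓᶠ v ≤ wireᴺ (toℕ v)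
    below-step : ∀ {v w} → Gen word v w → Below w → Below v
    below-step {w = w} g = let v<w , adj = Gen⇒adjacent g in wireᴺ≤ℓ-backward v<w (toℕ<n w) adj
    above-step : ∀ {v w} → Gen word v w → Above v → Above w
    above-step {w = w} g = let v<w , adj = Gen⇒adjacent g in ℓ≤wireᴺ-forward v<w (toℕ<n w) adj
    below-z : Below z
    below-z = wireᴺ-came-from-below (toℕ<n z)
      (≤-trans (proj₂ (σ-range (suc (toℕ z)) N (s≤s z≤n , ≤-refl)))
               (≤-reflexive (cong suc (sym ℓz≡n))))
    above-y : Above y
    above-y = ≤-trans (≤-reflexive ℓy≡1) (proj₁ (σ-range (toℕ y) N (s≤s z≤n , ≤-refl)))

  InD-path : ∀ {x y : Pos} → InD (toℕ x) → InD (toℕ y) → ℓᶠ y ≤ ℓᶠ x → Pw word x y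
  InD-path {y = y} inDx inDy ℓy≤ℓx = go _ inDx (sym (m∸n+n≡m ℓy≤ℓx))
    where
    go : ∀ k {x} → InD (toℕ x) → ℓᶠ x ≡ k + ℓᶠ y → Pw word x y
    go zero inDx ℓx≡ℓy = subst (Pw word _) (InD-injective inDx inDy ℓx≡ℓy) ε
    go (suc k) {x} inDx ℓx≡ =
      let x′ , ℓx′≡ , inDx′ = InD-exists (≤-trans (proj₁ (ℓᶠ-bounds y)) (m≤n+m _ k))
                                         (≤-trans (n≤1+n _) (≤-trans (≤-reflexive (sym ℓx≡))
                                                                     (proj₂ (ℓᶠ-bounds x))))
          ℓx≡1+ℓx′ = trans ℓx≡ (cong suc (sym ℓx′≡))
      in adjacent⇒Gen (InD-ordered inDx inDx′ (≤-reflexive (sym ℓx≡1+ℓx′))) (inj₁ ℓx≡1+ℓx′)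
         ◅ go k inDx′ ℓx′≡

  InA-path : ∀ {x y : Pos} → InA (toℕ x) → InA (toℕ y) → ℓᶠ x ≤ ℓᶠ y → Pw word x y
  InA-path {y = y} inAx inAy ℓx≤ℓy = go _ inAx (sym (m∸n+n≡m ℓx≤ℓy))
    where
    go : ∀ k {x} → InA (toℕ x) → ℓᶠ y ≡ k + ℓᶠ x → Pw word x y
    go zero inAx ℓy≡ℓx = subst (Pw word _) (InA-injective inAx inAy (sym ℓy≡ℓx)) ε
    go (suc k) {x} inAx ℓy≡ =
      let x′ , ℓx′≡ , inAx′ = InA-exists (s≤s z≤n)
                                         (≤-trans (s≤s (m≤n+m _ k)) (≤-trans (≤-reflexive (sym ℓy≡))
                                                                              (proj₂ (ℓᶠ-bounds y))))
      in adjacent⇒Gen (InA-ordered inAx inAx′ (≤-reflexive (sym ℓx′≡))) (inj₂ (sym ℓx′≡))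
         ◅ go k inAx′ (trans ℓy≡ (trans (sym (+-suc k _)) (cong (k +_) (sym ℓx′≡))))

-- The chains D and A

WordChain : (word : List ℕ) (n : ℕ) → (Fin n → ℕ) → (Fin n → Fin (length word)) → Set
WordChain word n labelOf ψ =
  (∀ i j → i <ᶠ j → Pw word (ψ i) (ψ j)) × (∀ i → lookup word (ψ i) ≡ labelOf i)

module _ {a r} {A : Set a} (R : Rel A r) (R-refl : Reflexive R) {m} (ψ : Fin (suc m) → A)
         (ψ-chain : ∀ i j → i <ᶠ j → R (ψ i) (ψ j)) where

  chain-from-first : ∀ k → R (ψ fzero) (ψ k)
  chain-from-first fzero = R-refl
  chain-from-first (fsuc k) = ψ-chain fzero (fsuc k) z<s

  chain-to-last : ∀ k → R (ψ k) (ψ (fromℕ m))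
  chain-to-last k with k ≟ᶠ fromℕ m
  ... | yes refl = R-refl
  ... | no k≢last = ψ-chain k (fromℕ m) (≤∧≢⇒<ᶠ (≤fromℕ k) k≢last)

module Chains {m : ℕ} {word : List ℕ} (reduced : Reduced (suc m) (w₀ (suc m)) word) where
  open Wires reduced

  labelD : Fin (suc m) → ℕ
  labelD k = suc m ∸ toℕ k

  labelA : Fin (suc m) → ℕ
  labelA k = suc (toℕ k)

  labelD-separated : ∀ i j → i <ᶠ j → labelD i ≢ labelD j
  labelD-separated i j i<j = <⇒≢ (∸-monoʳ-< i<j (<⇒≤ (toℕ<n j))) ∘ sym

  labelA-separated : ∀ i j → i <ᶠ j → labelA i ≢ labelA j
  labelA-separated i j i<j = <⇒≢ (s≤s i<j)

  ℓᶠ≡⇒lookup≡ : ∀ {x c} → ℓᶠ x ≡ c → lookup word x ≡ c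
  ℓᶠ≡⇒lookup≡ {x} ℓx≡c = trans (lookup≡letter word x) ℓx≡c

  lookup≡⇒ℓᶠ≡ : ∀ {x c} → lookup word x ≡ c → ℓᶠ x ≡ c
  lookup≡⇒ℓᶠ≡ {x} lookup≡c = trans (sym (lookup≡letter word x)) lookup≡c

  D-entry : ∀ k → Σ Pos λ x → ℓᶠ x ≡ labelD k × InD (toℕ x)
  D-entry k = InD-exists (m<n⇒0<n∸m (toℕ<n k)) (m∸n≤m (suc m) (toℕ k))

  D-element : Fin (suc m) → Pos
  D-element k = proj₁ (D-entry k)

  D-element-label : ∀ k → ℓᶠ (D-element k) ≡ labelD k
  D-element-label k = proj₁ (proj₂ (D-entry k))

  D-element-InD : ∀ k → InD (toℕ (D-element k))
  D-element-InD k = proj₂ (proj₂ (D-entry k))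

  A-entry : ∀ k → Σ Pos λ x → ℓᶠ x ≡ labelA k × InA (toℕ x)
  A-entry k = InA-exists (s≤s z≤n) (toℕ<n k)

  A-element : Fin (suc m) → Pos
  A-element k = proj₁ (A-entry k)

  A-element-label : ∀ k → ℓᶠ (A-element k) ≡ labelA k
  A-element-label k = proj₁ (proj₂ (A-entry k))

  A-element-InA : ∀ k → InA (toℕ (A-element k))
  A-element-InA k = proj₂ (proj₂ (A-entry k))

  D-chain : WordChain word (suc m) labelD D-element
  D-chain = (λ i j i<j → InD-path (D-element-InD i) (D-element-InD j) (labels-≤ i j i<j))
          , λ k → ℓᶠ≡⇒lookup≡ (D-element-label k)
    where
    labels-≤ : ∀ i j → i <ᶠ j → ℓᶠ (D-element j) ≤ ℓᶠ (D-element i)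
    labels-≤ i j i<j = subst₂ _≤_ (sym (D-element-label j)) (sym (D-element-label i))
                                  (∸-monoʳ-≤ (suc m) (<⇒≤ i<j))

  A-chain : WordChain word (suc m) labelA A-element
  A-chain = (λ i j i<j → InA-path (A-element-InA i) (A-element-InA j) (labels-≤ i j i<j))
          , λ k → ℓᶠ≡⇒lookup≡ (A-element-label k)
    where
    labels-≤ : ∀ i j → i <ᶠ j → ℓᶠ (A-element i) ≤ ℓᶠ (A-element j)
    labels-≤ i j i<j = subst₂ _≤_ (sym (A-element-label i)) (sym (A-element-label j))
                                  (s≤s (<⇒≤ i<j))

  D-chain-unique : ∀ ψ → WordChain word (suc m) labelD ψ → ∀ k → ψ k ≡ D-element k
  D-chain-unique ψ (ψ-chain , ψ-labels) k =
    InD-injective (InD-between (chain-from-first (Pw word) ε ψ ψ-chain k) (chain-to-last (Pw word) ε ψ ψ-chain k)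
                               (lookup≡⇒ℓᶠ≡ (ψ-labels fzero)) last-label)
                  (D-element-InD k) (trans (lookup≡⇒ℓᶠ≡ (ψ-labels k)) (sym (D-element-label k)))
    where
    last-label : ℓᶠ (ψ (fromℕ m)) ≡ 1
    last-label = trans (lookup≡⇒ℓᶠ≡ (ψ-labels (fromℕ m)))
                       (trans (cong (suc m ∸_) (toℕ-fromℕ m)) (m+n∸n≡m 1 m))

  A-chain-unique : ∀ ψ → WordChain word (suc m) labelA ψ → ∀ k → ψ k ≡ A-element k
  A-chain-unique ψ (ψ-chain , ψ-labels) k =
    InA-injective (InA-between (chain-from-first (Pw word) ε ψ ψ-chain k) (chain-to-last (Pw word) ε ψ ψ-chain k)
                               (lookup≡⇒ℓᶠ≡ (ψ-labels fzero)) last-label)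
                  (A-element-InA k) (trans (lookup≡⇒ℓᶠ≡ (ψ-labels k)) (sym (A-element-label k)))
    where
    last-label : ℓᶠ (ψ (fromℕ m)) ≡ suc m
    last-label = trans (lookup≡⇒ℓᶠ≡ (ψ-labels (fromℕ m))) (cong suc (toℕ-fromℕ m))

  InD⇒D-element : ∀ {x} → InD (toℕ x) → Σ (Fin (suc m)) λ k → D-element k ≡ x
  InD⇒D-element {x} inD = k , InD-injective (D-element-InD k) inD (trans (D-element-label k) labelD-k)
    where
    1≤ℓx = proj₁ (ℓᶠ-bounds x)
    ℓx≤n = proj₂ (ℓᶠ-bounds x)
    index< : suc m ∸ ℓᶠ x < suc m
    index< = ∸-monoʳ-< {o = 0} 1≤ℓx ℓx≤n
    k : Fin (suc m)
    k = fromℕ< index<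
    labelD-k : labelD k ≡ ℓᶠ x
    labelD-k = trans (cong (suc m ∸_) (toℕ-fromℕ< index<)) (m∸[m∸n]≡n ℓx≤n)

  InA⇒A-element : ∀ {x} → InA (toℕ x) → Σ (Fin (suc m)) λ k → A-element k ≡ x
  InA⇒A-element {x} inA = k , InA-injective (A-element-InA k) inA (trans (A-element-label k) labelA-k)
    where
    1≤ℓx = proj₁ (ℓᶠ-bounds x)
    ℓx≤n = proj₂ (ℓᶠ-bounds x)
    index< : pred (ℓᶠ x) < suc m
    index< = s≤s (pred-mono-≤ ℓx≤n)
    k : Fin (suc m)
    k = fromℕ< index<
    labelA-k : labelA k ≡ ℓᶠ x
    labelA-k = trans (cong suc (toℕ-fromℕ< index<)) (suc-pred (ℓᶠ x) ⦃ >-nonZero 1≤ℓx ⦄)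

  D-meets-A : Σ (Fin (suc m)) λ i → Σ (Fin (suc m)) λ j → D-element i ≡ A-element j
  D-meets-A with InD∧InA-exists (s≤s z≤n)
  ... | x , inD , inA with InD⇒D-element inD | InA⇒A-element inA
  ...   | i , Di≡x | j , Aj≡x = i , j , trans Di≡x (sym Aj≡x)

  D-meets-A-once : ∀ i j i′ j′ → D-element i ≡ A-element j → D-element i′ ≡ A-element j′ →
                   D-element i ≡ D-element i′
  D-meets-A-once i j i′ j′ Di≡Aj Di′≡Aj′ =
    InD∧InA-unique (D-element-InD i) (subst (InA ∘ toℕ) (sym Di≡Aj) (A-element-InA j))
                   (D-element-InD i′) (subst (InA ∘ toℕ) (sym Di′≡Aj′) (A-element-InA j′))

-- Transport along P ∼ P_𝐢

-- IsDChain and IsAChain are Chain with the labellings labelD and labelA, definitionally.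
Chain : (P : WordPoset) (n : ℕ) → (Fin n → ℕ) → (Fin n → Fin (size P)) → Set
Chain P n labelOf d =
  (∀ i j → i <ᶠ j → StrictP P (d i) (d j)) × (∀ i → label P (d i) ≡ labelOf i)

module Transport {P : WordPoset} {word : List ℕ} (iso : IsoToPword P word) where
  open Inverse (proj₁ iso) using (to; from; strictlyInverseˡ; strictlyInverseʳ)

  from-injective : ∀ {x y} → from x ≡ from y → x ≡ y
  from-injective {x} {y} eq =
    trans (sym (strictlyInverseˡ x)) (trans (cong to eq) (strictlyInverseˡ y))

  label-from : ∀ x → label P (from x) ≡ lookup word x
  label-from x = trans (sym (proj₂ (proj₂ iso) (from x))) (cong (lookup word) (strictlyInverseˡ x))

  ≤P⇒Pw : ∀ {x y} → _≤P_ P x y → Pw word (to x) (to y)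
  ≤P⇒Pw {x} {y} = Equivalence.to (proj₁ (proj₂ iso) x y)

  Pw⇒≤P : ∀ {x y} → Pw word x y → _≤P_ P (from x) (from y)
  Pw⇒≤P {x} {y} x≤y = Equivalence.from (proj₁ (proj₂ iso) (from x) (from y))
    (subst₂ (Pw word) (sym (strictlyInverseˡ x)) (sym (strictlyInverseˡ y)) x≤y)

  WordChain⇒Chain : ∀ {n labelOf ψ} → (∀ i j → i <ᶠ j → labelOf i ≢ labelOf j) →
                    WordChain word n labelOf ψ → Chain P n labelOf (from ∘ ψ)
  WordChain⇒Chain {labelOf = labelOf} {ψ} separated (ψ-chain , ψ-labels) =
    (λ i j i<j → Pw⇒≤P (ψ-chain i j i<j) , separated i j i<j ∘ labels-agree i j) , labelled
    where
    labelled : ∀ i → label P (from (ψ i)) ≡ labelOf i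
    labelled i = trans (label-from (ψ i)) (ψ-labels i)
    labels-agree : ∀ i j → from (ψ i) ≡ from (ψ j) → labelOf i ≡ labelOf j
    labels-agree i j same = trans (sym (labelled i)) (trans (cong (label P) same) (labelled j))

  Chain⇒WordChain : ∀ {n labelOf d} → Chain P n labelOf d → WordChain word n labelOf (to ∘ d)
  Chain⇒WordChain (d-chain , d-labels) =
    (λ i j i<j → ≤P⇒Pw (proj₁ (d-chain i j i<j))) , λ i → trans (proj₂ (proj₂ iso) _) (d-labels i)

  Chain-unique : ∀ {n labelOf} (ψ : Fin n → Fin (length word)) →
                 (∀ ψ′ → WordChain word n labelOf ψ′ → ∀ k → ψ′ k ≡ ψ k) →
                 ∀ d′ → Chain P n labelOf d′ → ∀ k → d′ k ≡ from (ψ k)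
  Chain-unique ψ ψ-unique d′ d′-chain k =
    trans (sym (strictlyInverseʳ (d′ k)))
          (cong from (ψ-unique (to ∘ d′) (Chain⇒WordChain d′-chain) k))

proposition3p3 : (n : ℕ) → 1 ≤ n → (P : WordPoset) → InClass n (w₀ n) P →
  Σ (Fin n → Fin (size P)) λ d →
    IsDChain P n d × (∀ d′ → IsDChain P n d′ → ∀ i → d′ i ≡ d i) ×
  Σ (Fin n → Fin (size P)) λ a →
    IsAChain P n a × (∀ a′ → IsAChain P n a′ → ∀ i → a′ i ≡ a i) ×
    Σ (Fin n) (λ i → Σ (Fin n) λ j → d i ≡ a j) ×
    (∀ i j i′ j′ → d i ≡ a j → d i′ ≡ a j′ → d i ≡ d i′)
proposition3p3 zero () _ _
proposition3p3 (suc m) _ P (word , reduced , iso) =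
  let i₀ , j₀ , D≡A = D-meets-A in
  from ∘ D-element , WordChain⇒Chain labelD-separated D-chain , Chain-unique D-element D-chain-unique ,
  from ∘ A-element , WordChain⇒Chain labelA-separated A-chain , Chain-unique A-element A-chain-unique ,
  (i₀ , j₀ , cong from D≡A) ,
  λ i j i′ j′ d≡a d′≡a′ →
    cong from (D-meets-A-once i j i′ j′ (from-injective d≡a) (from-injective d′≡a′))
  where
  open Chains reduced
  open Transport {P} {word} iso
  open Inverse (proj₁ iso) using (from)
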